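{- Let $\psi(\mathbf{z})$ be a first-order formula of the form $\psi(\mathbf{z}) := \bigvee_j \forall \mathbf{x}\, \exists \mathbf{y}.\, \chi_j(\mathbf{z}, \mathbf{x}, \mathbf{y})$ with quantifier-free $\chi_j$. Let $\mathrm{At}$ be the set of all atoms occurring in $\psi(\mathbf{z})$ and $q := 2^{|\mathrm{At}|}$. Then $\psi(\mathbf{z})$ is semantically equivalent to \[ \psi'(\mathbf{z}) := \exists \mathbf{v}_1 \ldots \mathbf{v}_q\, \exists \mathbf{y}_1 \ldots \mathbf{y}_q.\, \Bigl( \bigvee_j \bigwedge_{k = 1}^q \chi_j(\mathbf{z}, \mathbf{v}_k, \mathbf{y}_k) \Bigr) \wedge \forall \mathbf{x}\, \exists \mathbf{y}.\, \bigvee_{k = 1}^q \bigwedge_{A \in \mathrm{At}} \bigl( A(\mathbf{z}, \mathbf{x}, \mathbf{y}) \leftrightarrow A(\mathbf{z}, \mathbf{v}_k, \mathbf{y}_k) \bigr), \] where $\mathbf{v}_1, \ldots, \mathbf{v}_q, \mathbf{y}_1, \ldots, \mathbf{y}_q$ are tuples of fresh pairwise distinct variables with $|\mathbf{v}_k| = |\mathbf{x}|$ and $|\mathbf{y}_k| = |\mathbf{y}|$ for every $k$.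
   Context: For a formula $\theta(\mathbf{z},\mathbf{x},\mathbf{y})$, the notation $\theta(\mathbf{z}, \mathbf{v}_k, \mathbf{y}_k)$ denotes the result of substituting the variables of $\mathbf{v}_k$ and $\mathbf{y}_k$ componentwise for those of $\mathbf{x}$ and $\mathbf{y}$. Semantic equivalence means satisfaction by the same structures under the same variable assignments. -}

module Defs where

open import Level using (0ℓ)
open import Data.Nat using (ℕ; _*_; _^_)
open import Data.Fin using (Fin; combine)
open import Data.Vec using (Vec; []; _∷_)
open import Data.Sum using (_⊎_; inj₁; inj₂; [_,_])
open import Data.Product using (Σ; _×_; _,_)
open import Data.Unit using (⊤)
open import Data.Empty using (⊥)
open import Data.List using (List; []; _∷_; length)
open import Function using (id)
open import Relation.Binary.PropositionalEquality using (_≡_)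

record Signature : Set₁ where
  field
    FunSym   : Set
    RelSym   : Set
    funArity : FunSym → ℕ
    relArity : RelSym → ℕ

module _ (Σg : Signature) where
  open Signature Σg

  data Term (V : Set) : Set where
    var : V → Term V
    fun : (f : FunSym) → Vec (Term V) (funArity f) → Term V

  data Atom (V : Set) : Set where
    rel   : (R : RelSym) → Vec (Term V) (relArity R) → Atom V
    equal : Term V → Term V → Atom V

  data QF (V : Set) : Set where
    atom     : Atom V → QF V
    true false : QF V
    neg      : QF V → QF V
    _and_ _or_ _imp_ : QF V → QF V → QF V

  -- first-order formulas; quantifiers bind a block (tuple) of m fresh
  -- variables, which extend the scope V to V ⊎ Fin m
  data Formula (V : Set) : Set where
    atom     : Atom V → Formula V
    true false : Formula V
    neg      : Formula V → Formula V
    _and_ _or_ _imp_ : Formula V → Formula V → Formula V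
    all ex   : (m : ℕ) → Formula (V ⊎ Fin m) → Formula V

  ⌜_⌝ : ∀ {V} → QF V → Formula V
  ⌜ atom A ⌝    = atom A
  ⌜ true ⌝      = true
  ⌜ false ⌝     = false
  ⌜ neg φ ⌝     = neg ⌜ φ ⌝
  ⌜ φ and ψ ⌝   = ⌜ φ ⌝ and ⌜ ψ ⌝
  ⌜ φ or ψ ⌝    = ⌜ φ ⌝ or ⌜ ψ ⌝
  ⌜ φ imp ψ ⌝   = ⌜ φ ⌝ imp ⌜ ψ ⌝

  _iff_ : ∀ {V} → Formula V → Formula V → Formula V
  φ iff ψ = (φ imp ψ) and (ψ imp φ)

  ⋁ : ∀ {V} (n : ℕ) → (Fin n → Formula V) → Formula V
  ⋁ ℕ.zero    φ = false
  ⋁ (ℕ.suc n) φ = φ Fin.zero or ⋁ n (λ i → φ (Fin.suc i))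

  ⋀ : ∀ {V} (n : ℕ) → (Fin n → Formula V) → Formula V
  ⋀ ℕ.zero    φ = true
  ⋀ (ℕ.suc n) φ = φ Fin.zero and ⋀ n (λ i → φ (Fin.suc i))

  ⋀List : ∀ {V} → List (Formula V) → Formula V
  ⋀List []       = true
  ⋀List (φ ∷ φs) = φ and ⋀List φs

  mapList : ∀ {A B : Set} → (A → B) → List A → List B
  mapList f []       = []
  mapList f (x ∷ xs) = f x ∷ mapList f xs

  renTerm  : ∀ {V W} → (V → W) → Term V → Term W
  renTerms : ∀ {V W n} → (V → W) → Vec (Term V) n → Vec (Term W) n
  renTerm  ρ (var x)    = var (ρ x)
  renTerm  ρ (fun f ts) = fun f (renTerms ρ ts)
  renTerms ρ []         = []
  renTerms ρ (t ∷ ts)   = renTerm ρ t ∷ renTerms ρ ts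

  renAtom : ∀ {V W} → (V → W) → Atom V → Atom W
  renAtom ρ (rel R ts)  = rel R (renTerms ρ ts)
  renAtom ρ (equal s t) = equal (renTerm ρ s) (renTerm ρ t)

  renQF : ∀ {V W} → (V → W) → QF V → QF W
  renQF ρ (atom A)  = atom (renAtom ρ A)
  renQF ρ true      = true
  renQF ρ false     = false
  renQF ρ (neg φ)   = neg (renQF ρ φ)
  renQF ρ (φ and ψ) = renQF ρ φ and renQF ρ ψ
  renQF ρ (φ or ψ)  = renQF ρ φ or renQF ρ ψ
  renQF ρ (φ imp ψ) = renQF ρ φ imp renQF ρ ψ

  data _occursIn_ {V : Set} (A : Atom V) : QF V → Set where
    here  : A occursIn atom A
    neg↓  : ∀ {φ}   → A occursIn φ → A occursIn neg φ
    andˡ  : ∀ {φ ψ} → A occursIn φ → A occursIn (φ and ψ)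
    andʳ  : ∀ {φ ψ} → A occursIn ψ → A occursIn (φ and ψ)
    orˡ   : ∀ {φ ψ} → A occursIn φ → A occursIn (φ or ψ)
    orʳ   : ∀ {φ ψ} → A occursIn ψ → A occursIn (φ or ψ)
    impˡ  : ∀ {φ ψ} → A occursIn φ → A occursIn (φ imp ψ)
    impʳ  : ∀ {φ ψ} → A occursIn ψ → A occursIn (φ imp ψ)

  record Structure : Set₁ where
    field
      Carrier : Set
      inhabitant : Carrier
      funI : (f : FunSym) → Vec Carrier (funArity f) → Carrier
      relI : (R : RelSym) → Vec Carrier (relArity R) → Set

  module _ (M : Structure) where
    open Structure M

    evalTerm  : ∀ {V} → (V → Carrier) → Term V → Carrier
    evalTerms : ∀ {V n} → (V → Carrier) → Vec (Term V) n → Vec Carrier n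
    evalTerm  a (var x)    = a x
    evalTerm  a (fun f ts) = funI f (evalTerms a ts)
    evalTerms a []         = []
    evalTerms a (t ∷ ts)   = evalTerm a t ∷ evalTerms a ts

    satAtom : ∀ {V} → (V → Carrier) → Atom V → Set
    satAtom a (rel R ts)  = relI R (evalTerms a ts)
    satAtom a (equal s t) = evalTerm a s ≡ evalTerm a t

    sat : ∀ {V} → (V → Carrier) → Formula V → Set
    sat a (atom A)  = satAtom a A
    sat a true      = ⊤
    sat a false     = ⊥
    sat a (neg φ)   = sat a φ → ⊥
    sat a (φ and ψ) = sat a φ × sat a ψ
    sat a (φ or ψ)  = sat a φ ⊎ sat a ψ
    sat a (φ imp ψ) = sat a φ → sat a ψ
    sat a (all m φ) = (b : Fin m → Carrier) → sat [ a , b ] φ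
    sat a (ex m φ)  = Σ (Fin m → Carrier) (λ b → sat [ a , b ] φ)

  _≋_ : ∀ {V} → Formula V → Formula V → Set₁
  _≋_ {V} φ ψ = (M : Structure) (a : V → Structure.Carrier M) →
                (sat M a φ → sat M a ψ) × (sat M a ψ → sat M a φ)

  -- The formulas ψ and ψ' of the theorem.
  -- z has length nz, x has length nx, y has length ny; the matrices χ_j
  -- (j < J) are quantifier-free formulas in the variables z, x, y.

  Scope : ℕ → ℕ → ℕ → Set
  Scope nz nx ny = (Fin nz ⊎ Fin nx) ⊎ Fin ny

  psi : ∀ {nz nx ny J} → (Fin J → QF (Scope nz nx ny)) → Formula (Fin nz)
  psi {nz} {nx} {ny} {J} χ = ⋁ J (λ j → all nx (ex ny ⌜ χ j ⌝))

  -- scope after ∃ v_1..v_q ∃ y_1..y_q; v_k's i-th variable is combine k i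
  Scope' : ℕ → ℕ → ℕ → ℕ → Set
  Scope' q nz nx ny = (Fin nz ⊎ Fin (q * nx)) ⊎ Fin (q * ny)

  σ : ∀ {q nz nx ny} → Fin q → Scope nz nx ny → Scope' q nz nx ny
  σ k (inj₁ (inj₁ z)) = inj₁ (inj₁ z)
  σ k (inj₁ (inj₂ i)) = inj₁ (inj₂ (combine k i))
  σ k (inj₂ i)        = inj₂ (combine k i)

  -- the variables z, x, y inside ∃v ∃y ... ∀x ∃y
  τ : ∀ {q nz nx ny} → Scope nz nx ny → (Scope' q nz nx ny ⊎ Fin nx) ⊎ Fin ny
  τ (inj₁ (inj₁ z)) = inj₁ (inj₁ (inj₁ (inj₁ z)))
  τ (inj₁ (inj₂ i)) = inj₁ (inj₂ i)
  τ (inj₂ i)        = inj₂ i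

  -- v_k, y_k seen inside the inner ∀x ∃y
  τ' : ∀ {q nz nx ny} → Fin q → Scope nz nx ny → (Scope' q nz nx ny ⊎ Fin nx) ⊎ Fin ny
  τ' k v = inj₁ (inj₁ (σ k v))

  psi' : ∀ {nz nx ny J} → (Fin J → QF (Scope nz nx ny)) →
         List (Atom (Scope nz nx ny)) → Formula (Fin nz)
  psi' {nz} {nx} {ny} {J} χ At =
    ex (q * nx) (ex (q * ny)
      (⋁ J (λ j → ⋀ q (λ k → ⌜ renQF (σ {q} k) (χ j) ⌝))
       and all nx (ex ny
         (⋁ q (λ k → ⋀List (mapList
            (λ A → atom (renAtom (τ {q}) A) iff atom (renAtom (τ' {q} k) A)) At))))))
    where q = 2 ^ length At

-- Fix a structure and z, and (in the nontrivial direction) a disjunct j with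
-- Skolem function f, so that ∀x χ_j(z, x, f x). The atomic type of (x, f x)
-- is one of at most q truth assignments to At. Choosing for every realised
-- type a representative v_k and putting y_k := f v_k gives witnesses for ψ':
-- each χ_j(z, v_k, y_k) holds, and every x shares its type with some
-- (v_k, y_k). Conversely, χ_j(z, x, y) depends only on the truth values of
-- the atoms of χ_j, so sharing the type of a witness (v_k, y_k) suffices.
-- Choosing the representatives needs excluded middle.
module Submission where

open import Defs
open import Level using (0ℓ)
open import Axiom.ExcludedMiddle using (ExcludedMiddle)
open import Data.Nat using (ℕ; _*_; _^_)
open import Data.Fin using (Fin; zero; suc; combine; remQuot)
open import Data.Fin.Properties using (remQuot-combine; combine-injective)
open import Data.Product using (Σ; Σ-syntax; _×_; _,_; proj₁; proj₂; uncurry)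
open import Data.Product.Function.NonDependent.Propositional using (_×-⇔_)
open import Data.Sum using (inj₁; inj₂; [_,_])
open import Data.Sum.Function.Propositional using (_⊎-⇔_)
open import Data.Unit using (tt)
open import Data.Empty using (⊥-elim)
open import Data.Vec using (Vec; []; _∷_)
open import Data.List using (List; []; _∷_; length)
open import Data.List.Membership.Propositional using (_∈_)
open import Data.List.Relation.Unary.Any using (here; there)
open import Data.List.Relation.Unary.Unique.Propositional using (Unique)
open import Function using (_∘_; const; _⇔_; mk⇔; Equivalence)
open import Function.Construct.Identity using (⇔-id)
open import Function.Related.TypeIsomorphisms using (→-cong-⇔; ¬-cong-⇔)
open import Relation.Nullary using (Dec; yes; no)
open import Relation.Binary.PropositionalEquality using (_≡_; _≗_; refl; sym; cong; cong₂)

open Equivalence using (to; from)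

flatten : ∀ {C : Set} {q n} → (Fin q → Fin n → C) → Fin (q * n) → C
flatten {n = n} V m = uncurry V (remQuot n m)

flatten-combine : ∀ {C : Set} {q n} (V : Fin q → Fin n → C) k i →
                  flatten V (combine k i) ≡ V k i
flatten-combine {n = n} V k i = cong (uncurry V) (remQuot-combine {k = n} k i)

module _ (lem : ExcludedMiddle 0ℓ) where

  module _ {X K : Set} (x₀ : X) (type : X → K) where

    representative : K → X
    representative k with lem {Σ[ x ∈ X ] type x ≡ k}
    ... | yes (x , _) = x
    ... | no _        = x₀

    representative-realises : ∀ x → type (representative (type x)) ≡ type x
    representative-realises x with lem {Σ[ x′ ∈ X ] type x′ ≡ type x}
    ... | yes (_ , eq) = eq
    ... | no ¬realised = ⊥-elim (¬realised (x , refl))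

  bit : {P : Set} → Dec P → Fin 2
  bit (yes _) = zero
  bit (no _)  = suc zero

  bit-injective : {P Q : Set} (p : Dec P) (q : Dec Q) → bit p ≡ bit q → P ⇔ Q
  bit-injective (yes p) (yes q) _  = mk⇔ (const q) (const p)
  bit-injective (no ¬p) (no ¬q) _  = mk⇔ (⊥-elim ∘ ¬p) (⊥-elim ∘ ¬q)
  bit-injective (yes _) (no _)  ()
  bit-injective (no _)  (yes _) ()

  truthCode : {B : Set} (As : List B) → (B → Set) → Fin (2 ^ length As)
  truthCode []       P = zero
  truthCode (A ∷ As) P = combine (bit (lem {P A})) (truthCode As P)

  truthCode-injective : {B : Set} (As : List B) (P Q : B → Set) →
                        truthCode As P ≡ truthCode As Q →
                        ∀ {A} → A ∈ As → P A ⇔ Q A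
  truthCode-injective (A ∷ As) P Q eq A∈A∷As
    with combine-injective (bit (lem {P A})) (truthCode As P) (bit (lem {Q A})) (truthCode As Q) eq
  ... | bitP≡bitQ , codeP≡codeQ with A∈A∷As
  ...   | here refl   = bit-injective lem lem bitP≡bitQ
  ...   | there A∈As = truthCode-injective As P Q codeP≡codeQ A∈As

module Semantics {Σg : Signature} (M : Structure Σg) where
  open Structure M

  _⊨_ : ∀ {V} → (V → Carrier) → Formula Σg V → Set
  a ⊨ φ = sat Σg M a φ

  _⊨ₐ_ : ∀ {V} → (V → Carrier) → Atom Σg V → Set
  a ⊨ₐ A = satAtom Σg M a A

  module _ {V W : Set} (ρ : V → W) {c : W → Carrier} {d : V → Carrier}
           (c∘ρ≗d : c ∘ ρ ≗ d) where

    evalTerm-renTerm : ∀ t → evalTerm Σg M c (renTerm Σg ρ t) ≡ evalTerm Σg M d t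
    evalTerms-renTerms : ∀ {n} (ts : Vec (Term Σg V) n) →
      evalTerms Σg M c (renTerms Σg ρ ts) ≡ evalTerms Σg M d ts
    evalTerm-renTerm (var x)    = c∘ρ≗d x
    evalTerm-renTerm (fun f ts) = cong (funI f) (evalTerms-renTerms ts)
    evalTerms-renTerms []       = refl
    evalTerms-renTerms (t ∷ ts) = cong₂ _∷_ (evalTerm-renTerm t) (evalTerms-renTerms ts)

    satAtom-renAtom : ∀ A → c ⊨ₐ renAtom Σg ρ A ⇔ d ⊨ₐ A
    satAtom-renAtom (rel R ts) rewrite evalTerms-renTerms ts = ⇔-id _
    satAtom-renAtom (equal s t)
      rewrite evalTerm-renTerm s | evalTerm-renTerm t = ⇔-id _

    sat-renQF : ∀ φ → c ⊨ ⌜_⌝ Σg (renQF Σg ρ φ) ⇔ d ⊨ ⌜_⌝ Σg φ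
    sat-renQF (atom A)  = satAtom-renAtom A
    sat-renQF true      = ⇔-id _
    sat-renQF false     = ⇔-id _
    sat-renQF (neg φ)   = ¬-cong-⇔ (sat-renQF φ)
    sat-renQF (φ and ψ) = sat-renQF φ ×-⇔ sat-renQF ψ
    sat-renQF (φ or ψ)  = sat-renQF φ ⊎-⇔ sat-renQF ψ
    sat-renQF (φ imp ψ) = →-cong-⇔ (sat-renQF φ) (sat-renQF ψ)

  sat-QF-atoms : ∀ {V} {c d : V → Carrier} φ →
                 (∀ {A} → _occursIn_ Σg A φ → c ⊨ₐ A ⇔ d ⊨ₐ A) →
                 c ⊨ ⌜_⌝ Σg φ ⇔ d ⊨ ⌜_⌝ Σg φ
  sat-QF-atoms (atom A)  agree = agree here
  sat-QF-atoms true      agree = ⇔-id _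
  sat-QF-atoms false     agree = ⇔-id _
  sat-QF-atoms (neg φ)   agree = ¬-cong-⇔ (sat-QF-atoms φ (agree ∘ neg↓))
  sat-QF-atoms (φ and ψ) agree =
    sat-QF-atoms φ (agree ∘ andˡ) ×-⇔ sat-QF-atoms ψ (agree ∘ andʳ)
  sat-QF-atoms (φ or ψ)  agree =
    sat-QF-atoms φ (agree ∘ orˡ) ⊎-⇔ sat-QF-atoms ψ (agree ∘ orʳ)
  sat-QF-atoms (φ imp ψ) agree =
    →-cong-⇔ (sat-QF-atoms φ (agree ∘ impˡ)) (sat-QF-atoms ψ (agree ∘ impʳ))

  module _ {V : Set} (a : V → Carrier) where

    sat-⋁⁻ : ∀ n (φ : Fin n → Formula Σg V) → a ⊨ ⋁ Σg n φ → Σ[ i ∈ Fin n ] a ⊨ φ i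
    sat-⋁⁻ (ℕ.suc n) φ (inj₁ s) = zero , s
    sat-⋁⁻ (ℕ.suc n) φ (inj₂ s) with sat-⋁⁻ n (φ ∘ suc) s
    ... | i , sᵢ = suc i , sᵢ

    sat-⋁⁺ : ∀ n (φ : Fin n → Formula Σg V) i → a ⊨ φ i → a ⊨ ⋁ Σg n φ
    sat-⋁⁺ (ℕ.suc n) φ zero    s = inj₁ s
    sat-⋁⁺ (ℕ.suc n) φ (suc i) s = inj₂ (sat-⋁⁺ n (φ ∘ suc) i s)

    sat-⋀⁻ : ∀ n (φ : Fin n → Formula Σg V) → a ⊨ ⋀ Σg n φ → ∀ i → a ⊨ φ i
    sat-⋀⁻ (ℕ.suc n) φ (s , _) zero    = s
    sat-⋀⁻ (ℕ.suc n) φ (_ , s) (suc i) = sat-⋀⁻ n (φ ∘ suc) s i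

    sat-⋀⁺ : ∀ n (φ : Fin n → Formula Σg V) → (∀ i → a ⊨ φ i) → a ⊨ ⋀ Σg n φ
    sat-⋀⁺ ℕ.zero    φ s = tt
    sat-⋀⁺ (ℕ.suc n) φ s = s zero , sat-⋀⁺ n (φ ∘ suc) (s ∘ suc)

    sat-⋀List⁻ : ∀ {X : Set} (φ : X → Formula Σg V) xs →
                 a ⊨ ⋀List Σg (mapList Σg φ xs) → ∀ {x} → x ∈ xs → a ⊨ φ x
    sat-⋀List⁻ φ (x ∷ xs) (s , _) (here refl)  = s
    sat-⋀List⁻ φ (x ∷ xs) (_ , s) (there x∈xs) = sat-⋀List⁻ φ xs s x∈xs

    sat-⋀List⁺ : ∀ {X : Set} (φ : X → Formula Σg V) xs →
                 (∀ {x} → x ∈ xs → a ⊨ φ x) → a ⊨ ⋀List Σg (mapList Σg φ xs)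
    sat-⋀List⁺ φ []       s = tt
    sat-⋀List⁺ φ (x ∷ xs) s = s (here refl) , sat-⋀List⁺ φ xs (s ∘ there)

    sat-iff-cong : ∀ φ ψ {P Q : Set} → a ⊨ φ ⇔ P → a ⊨ ψ ⇔ Q →
                   a ⊨ _iff_ Σg φ ψ ⇔ (P ⇔ Q)
    sat-iff-cong φ ψ φ⇔P ψ⇔Q = mk⇔
      (λ (φ→ψ , ψ→φ) → mk⇔ (to ψ⇔Q ∘ φ→ψ ∘ from φ⇔P) (to φ⇔P ∘ ψ→φ ∘ from ψ⇔Q))
      (λ P⇔Q → from ψ⇔Q ∘ to P⇔Q ∘ to φ⇔P , from φ⇔P ∘ from P⇔Q ∘ to ψ⇔Q)

module _ {Σg : Signature} (M : Structure Σg) {nz nx ny J : ℕ}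
         (χ : Fin J → QF Σg (Scope Σg nz nx ny)) (a : Fin nz → Structure.Carrier M) where
  open Structure M
  open Semantics M

  env : (Fin nx → Carrier) → (Fin ny → Carrier) → Scope Σg nz nx ny → Carrier
  env xs ys = [ [ a , xs ] , ys ]

  AgreeOn : ∀ {V} → List (Atom Σg V) → (V → Carrier) → (V → Carrier) → Set
  AgreeOn As c d = ∀ {A} → A ∈ As → c ⊨ₐ A ⇔ d ⊨ₐ A

  -- The content of ψ' over a: q witnesses (v_k, y_k) satisfying one χ_j, such
  -- that every x extends to some (x, y) with the atomic type of a witness.
  record Witnesses (q : ℕ) (At : List (Atom Σg (Scope Σg nz nx ny))) : Set where
    field
      vs      : Fin q → Fin nx → Carrier
      ys      : Fin q → Fin ny → Carrier
      j       : Fin J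
      χ-holds : ∀ k → env (vs k) (ys k) ⊨ ⌜_⌝ Σg (χ j)
      covers  : ∀ xs → Σ[ y ∈ (Fin ny → Carrier) ] Σ[ k ∈ Fin q ]
                  AgreeOn At (env xs y) (env (vs k) (ys k))

  witnesses⇒psi : ∀ {q At} →
                  (∀ {A} j → _occursIn_ Σg A (χ j) → A ∈ At) →
                  Witnesses q At → a ⊨ psi Σg χ
  witnesses⇒psi atoms⊆At w = sat-⋁⁺ a J _ j λ xs →
    let (y , k , agree) = covers xs
    in y , from (sat-QF-atoms (χ j) (agree ∘ atoms⊆At j)) (χ-holds k)
    where open Witnesses w

  module _ (At : List (Atom Σg (Scope Σg nz nx ny))) where

    q : ℕ
    q = 2 ^ length At

    psi⇒witnesses : ExcludedMiddle 0ℓ → a ⊨ psi Σg χ → Witnesses q At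
    psi⇒witnesses lem s with sat-⋁⁻ a J _ s
    ... | j , H = record
      { vs      = vs
      ; ys      = f ∘ vs
      ; j       = j
      ; χ-holds = proj₂ ∘ H ∘ vs
      ; covers  = λ xs → f xs , type xs , λ A∈At →
          truthCode-injective lem At _ _ (sym (representative-realises lem _ type xs)) A∈At
      }
      where
      f : (Fin nx → Carrier) → Fin ny → Carrier
      f = proj₁ ∘ H
      type : (Fin nx → Carrier) → Fin q
      type xs = truthCode lem At (env xs (f xs) ⊨ₐ_)
      vs : Fin q → Fin nx → Carrier
      vs = representative lem (const inhabitant) type

    module BlockAssignment (BV : Fin (q * nx) → Carrier) (BY : Fin (q * ny) → Carrier)
                           (vs : Fin q → Fin nx → Carrier) (ys : Fin q → Fin ny → Carrier)
                           (BV-vs : ∀ k i → BV (combine k i) ≡ vs k i)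
                           (BY-ys : ∀ k i → BY (combine k i) ≡ ys k i) where

      a′ : Scope' Σg q nz nx ny → Carrier
      a′ = [ [ a , BV ] , BY ]

      a′∘σ≗env : ∀ k → a′ ∘ σ Σg {q} k ≗ env (vs k) (ys k)
      a′∘σ≗env k (inj₁ (inj₁ z)) = refl
      a′∘σ≗env k (inj₁ (inj₂ i)) = BV-vs k i
      a′∘σ≗env k (inj₂ i)        = BY-ys k i

      sat-χ-σ : ∀ k j → a′ ⊨ ⌜_⌝ Σg (renQF Σg (σ Σg {q} k) (χ j))
                      ⇔ env (vs k) (ys k) ⊨ ⌜_⌝ Σg (χ j)
      sat-χ-σ k j = sat-renQF (σ Σg {q} k) (a′∘σ≗env k) (χ j)

      sat-same-type : ∀ xs y k A →
        [ [ a′ , xs ] , y ]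
          ⊨ _iff_ Σg (atom (renAtom Σg (τ Σg {q}) A)) (atom (renAtom Σg (τ' Σg {q} k) A))
          ⇔ (env xs y ⊨ₐ A ⇔ env (vs k) (ys k) ⊨ₐ A)
      sat-same-type xs y k A = sat-iff-cong _
        (atom (renAtom Σg (τ Σg {q}) A)) (atom (renAtom Σg (τ' Σg {q} k) A)) renamed-τ renamed-τ′
        where
        renamed-τ : [ [ a′ , xs ] , y ] ⊨ₐ renAtom Σg (τ Σg {q}) A ⇔ env xs y ⊨ₐ A
        renamed-τ = satAtom-renAtom (τ Σg {q})
          (λ { (inj₁ (inj₁ _)) → refl ; (inj₁ (inj₂ _)) → refl ; (inj₂ _) → refl }) A
        renamed-τ′ : [ [ a′ , xs ] , y ] ⊨ₐ renAtom Σg (τ' Σg {q} k) A ⇔ env (vs k) (ys k) ⊨ₐ A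
        renamed-τ′ = satAtom-renAtom (τ' Σg {q} k) (a′∘σ≗env k) A

    witnesses⇒psi' : Witnesses q At → a ⊨ psi' Σg χ At
    witnesses⇒psi' w = BV , BY
      , sat-⋁⁺ a′ J _ j (sat-⋀⁺ a′ q _ λ k → from (sat-χ-σ k j) (χ-holds k))
      , λ xs → let (y , k , agree) = covers xs in
          y , sat-⋁⁺ _ q _ k (sat-⋀List⁺ _ _ At λ {A} A∈At →
                                from (sat-same-type xs y k A) (agree A∈At))
      where
      open Witnesses w
      BV : Fin (q * nx) → Carrier
      BV = flatten vs
      BY : Fin (q * ny) → Carrier
      BY = flatten ys
      open BlockAssignment BV BY vs ys (flatten-combine vs) (flatten-combine ys)

    psi'⇒witnesses : a ⊨ psi' Σg χ At → Witnesses q At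
    psi'⇒witnesses (BV , BY , s-χ , s-cover) with sat-⋁⁻ [ [ a , BV ] , BY ] J _ s-χ
    ... | j , s-χⱼ = record
      { vs      = vs
      ; ys      = ys
      ; j       = j
      ; χ-holds = λ k → to (sat-χ-σ k j) (sat-⋀⁻ a′ q _ s-χⱼ k)
      ; covers  = λ xs → let (y , s) = s-cover xs; (k , sₖ) = sat-⋁⁻ _ q _ s in
          y , k , λ {A} A∈At → to (sat-same-type xs y k A) (sat-⋀List⁻ _ _ At sₖ A∈At)
      }
      where
      vs : Fin q → Fin nx → Carrier
      vs k i = BV (combine k i)
      ys : Fin q → Fin ny → Carrier
      ys k i = BY (combine k i)
      open BlockAssignment BV BY vs ys (λ _ _ → refl) (λ _ _ → refl)

mainTheorem4 : ExcludedMiddle 0ℓ →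
    (Σg : Signature) (nz nx ny J : ℕ)
    (χ : Fin J → QF Σg (Scope Σg nz nx ny))
    (At : List (Atom Σg (Scope Σg nz nx ny))) →
    Unique At →
    ((A : Atom Σg (Scope Σg nz nx ny)) →
      (A ∈ At → Σ (Fin J) (λ j → _occursIn_ Σg A (χ j))) ×
      (Σ (Fin J) (λ j → _occursIn_ Σg A (χ j)) → A ∈ At)) →
    _≋_ Σg (psi Σg χ) (psi' Σg χ At)
mainTheorem4 lem Σg nz nx ny J χ At _ atoms M a =
    witnesses⇒psi' M χ a At ∘ psi⇒witnesses M χ a At lem
  , witnesses⇒psi M χ a (λ j A∈χⱼ → proj₂ (atoms _) (j , A∈χⱼ)) ∘ psi'⇒witnesses M χ a At
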